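{- Let $G$ be a prime tournament and let $u\in V(G)$. Let $H_1,H_2$ be prime subtournaments of $G$ such that $V(H_1)\cup V(H_2)=V(G)\setminus\{u\}$, the tournaments $H_1+u$ and $H_2+u$ are not prime, and the subtournament $H_{1,2}$ induced on $V(H_1)\cap V(H_2)$ is prime with $|V(H_{1,2})|\ge 3$. Then either there exists $x\in V(H_1)\setminus V(H_2)$ such that $\{u,x\}$ is a homogeneous set of $H_1+u$, or there exists $y\in V(H_2)\setminus V(H_1)$ such that $\{u,y\}$ is a homogeneous set of $H_2+u$.
   Context: A tournament has exactly one directed edge between any two distinct vertices; a subtournament is the tournament induced on a nonempty vertex subset, and $H+u$ denotes the subtournament induced on $V(H)\cup\{u\}$. A homogeneous set of $G$ is $X\subseteq V(G)$ such that each $v\in V(G)\setminus X$ either beats every vertex of $X$ or is beaten by every vertex of $X$; it is nontrivial if $1<|X|<|V(G)|$, and $G$ is prime if it has no nontrivial homogeneous set. -}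

module Defs where

open import Data.Nat using (ℕ; _<_)
open import Data.Fin using (Fin)
open import Data.Fin.Subset using (Subset; _∈_; _∉_; _⊆_; _∪_; ⁅_⁆; ∣_∣; Nonempty)
open import Data.Product using (_×_)
open import Data.Sum using (_⊎_)
open import Relation.Nullary using (¬_)
open import Relation.Binary.PropositionalEquality using (_≡_)

record Tournament (n : ℕ) : Set₁ where
  field
    _⇒_      : Fin n → Fin n → Set
    irrefl   : ∀ x → ¬ (x ⇒ x)
    total    : ∀ x y → ¬ (x ≡ y) → (x ⇒ y) ⊎ (y ⇒ x)
    asym     : ∀ x y → x ⇒ y → ¬ (y ⇒ x)

open Tournament public

-- Subtournaments are represented by their (nonempty) vertex sets S ⊆ V(G);
-- the subtournament induced on S is G restricted to S.

IsHomogeneous : ∀ {n} (G : Tournament n) (S X : Subset n) → Set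
IsHomogeneous G S X =
  X ⊆ S ×
  (∀ v → v ∈ S → v ∉ X →
     (∀ x → x ∈ X → _⇒_ G v x) ⊎ (∀ x → x ∈ X → _⇒_ G x v))

IsNontrivialHomogeneous : ∀ {n} (G : Tournament n) (S X : Subset n) → Set
IsNontrivialHomogeneous G S X =
  IsHomogeneous G S X × 1 < ∣ X ∣ × ∣ X ∣ < ∣ S ∣

IsPrime : ∀ {n} (G : Tournament n) (S : Subset n) → Set
IsPrime {n} G S = ∀ (X : Subset n) → ¬ IsNontrivialHomogeneous G S X

-- If H is prime and H+u is not, a nontrivial homogeneous set X of H+u meets H in
-- a homogeneous set of H, so either X ⊇ H (and then u ∉ X, so u beats all of H or
-- is beaten by all of H) or X = {u, x} for a single x ∈ H, a twin of u.  Applying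
-- this to H₁+u and H₂+u, a twin of u outside H₁ ∩ H₂ is the conclusion; every
-- other combination yields a nontrivial homogeneous set of G or of H₁ ∩ H₂:
-- V(G) ∖ {u} when u is uniform on both sides in the same direction (opposite
-- directions clash on H₁ ∩ H₂), H₁ ∩ H₂ ∖ {x} when u is uniform on one side and
-- has the twin x on the other, {u, x} in G when both sides give the same twin x,
-- and {x, y} in H₁ ∩ H₂ for two different twins x, y.

module Submission where

open import Defs
open import Data.Nat using (ℕ; _≤_; _<_; _+_; _<?_; z≤n; s≤s)
open import Data.Nat.Properties using (≮⇒≥; <⇒≱; ≤-trans; ≤-reflexive; +-suc; n≤1+n; +-monoʳ-≤)
open import Data.Fin using (Fin; _≟_)
open import Data.Fin.Properties using (any?; all?)
open import Data.Fin.Subset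
  using (Subset; ⊤; _∈_; _∉_; _⊆_; _∪_; _∩_; _─_; _-_; ⁅_⁆; ∣_∣; Nonempty; inside; outside)
open import Data.Fin.Subset.Properties
  using (_∈?_; _⊆?_; anySubset?; ∈⊤; x∈⁅x⁆; x∈⁅y⁆⇒x≡y; x≢y⇒x∉⁅y⁆; x∉⁅y⁆⇒x≢y; ∣⁅x⁆∣≡1;
         x∈p∪q⁺; x∈p∪q⁻; x∈p∩q⁺; p∩q⊆p; p∩q⊆q; p⊆p∪q; q⊆p∪q; p─q⊆p; x∈p∧x≢y⇒x∈p-y;
         ⊆-antisym; p⊆q⇒∣p∣≤∣q∣; p⊂q⇒∣p∣<∣q∣)
open import Data.Product using (Σ; ∃; _×_; _,_; proj₁)
open import Data.Sum using (_⊎_; inj₁; inj₂; [_,_]; [_,_]′)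
import Data.Sum as Sum
open import Data.Empty using (⊥; ⊥-elim)
open import Data.Vec using ([]; _∷_; here; there)
open import Function using (_∘_)
open import Relation.Nullary using (¬_; Dec; yes; no; ¬?; _×-dec_; _⊎-dec_; _→-dec_)
open import Relation.Binary.PropositionalEquality using (_≡_; _≢_; refl; sym; subst; cong₂)

private
  variable
    n : ℕ
    x y z u : Fin n
    p q S S₁ S₂ T X H K I : Subset n

x∈p─q⇒x∉q : x ∈ p ─ q → x ∉ q
x∈p─q⇒x∉q {p = inside ∷ p} {q = outside ∷ q} here ()
x∈p─q⇒x∉q {p = _ ∷ p} {q = _ ∷ q} (there x∈p─q) (there x∈q) = x∈p─q⇒x∉q x∈p─q x∈q

x∈p-y⇒x≢y : x ∈ p - y → x ≢ y
x∈p-y⇒x≢y {x = x} x∈p-x refl = x∈p─q⇒x∉q x∈p-x (x∈⁅x⁆ x)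

∣p∪q∣≤∣p∣+∣q∣ : ∀ (p q : Subset n) → ∣ p ∪ q ∣ ≤ ∣ p ∣ + ∣ q ∣
∣p∪q∣≤∣p∣+∣q∣ [] [] = z≤n
∣p∪q∣≤∣p∣+∣q∣ (inside ∷ p) (inside ∷ q) =
  s≤s (≤-trans (∣p∪q∣≤∣p∣+∣q∣ p q) (+-monoʳ-≤ ∣ p ∣ (n≤1+n ∣ q ∣)))
∣p∪q∣≤∣p∣+∣q∣ (inside ∷ p) (outside ∷ q) = s≤s (∣p∪q∣≤∣p∣+∣q∣ p q)
∣p∪q∣≤∣p∣+∣q∣ (outside ∷ p) (inside ∷ q) =
  ≤-trans (s≤s (∣p∪q∣≤∣p∣+∣q∣ p q)) (≤-reflexive (sym (+-suc ∣ p ∣ ∣ q ∣)))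
∣p∪q∣≤∣p∣+∣q∣ (outside ∷ p) (outside ∷ q) = ∣p∪q∣≤∣p∣+∣q∣ p q

x∈⁅x⁆∪⁅y⁆ : x ∈ ⁅ x ⁆ ∪ ⁅ y ⁆
x∈⁅x⁆∪⁅y⁆ {x = x} = x∈p∪q⁺ (inj₁ (x∈⁅x⁆ x))

y∈⁅x⁆∪⁅y⁆ : y ∈ ⁅ x ⁆ ∪ ⁅ y ⁆
y∈⁅x⁆∪⁅y⁆ {y = y} = x∈p∪q⁺ (inj₂ (x∈⁅x⁆ y))

x∈⁅y⁆∪⁅z⁆⁻ : x ∈ ⁅ y ⁆ ∪ ⁅ z ⁆ → x ≡ y ⊎ x ≡ z
x∈⁅y⁆∪⁅z⁆⁻ {y = y} {z = z} x∈ = Sum.map (x∈⁅y⁆⇒x≡y y) (x∈⁅y⁆⇒x≡y z) (x∈p∪q⁻ ⁅ y ⁆ ⁅ z ⁆ x∈)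

x≢y∧x≢z⇒x∉⁅y⁆∪⁅z⁆ : x ≢ y → x ≢ z → x ∉ ⁅ y ⁆ ∪ ⁅ z ⁆
x≢y∧x≢z⇒x∉⁅y⁆∪⁅z⁆ x≢y x≢z x∈ = [ x≢y , x≢z ] (x∈⁅y⁆∪⁅z⁆⁻ x∈)

x∉⁅y⁆∪⁅z⁆⇒x≢y : x ∉ ⁅ y ⁆ ∪ ⁅ z ⁆ → x ≢ y
x∉⁅y⁆∪⁅z⁆⇒x≢y x∉ refl = x∉ x∈⁅x⁆∪⁅y⁆

x∉⁅y⁆∪⁅z⁆⇒x≢z : x ∉ ⁅ y ⁆ ∪ ⁅ z ⁆ → x ≢ z
x∉⁅y⁆∪⁅z⁆⇒x≢z x∉ refl = x∉ y∈⁅x⁆∪⁅y⁆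

x∈p∧y∈p⇒⁅x⁆∪⁅y⁆⊆p : x ∈ p → y ∈ p → ⁅ x ⁆ ∪ ⁅ y ⁆ ⊆ p
x∈p∧y∈p⇒⁅x⁆∪⁅y⁆⊆p x∈p y∈p w∈ with x∈⁅y⁆∪⁅z⁆⁻ w∈
... | inj₁ refl = x∈p
... | inj₂ refl = y∈p

x∈p∧y∈p∧x≢y⇒1<∣p∣ : x ∈ p → y ∈ p → x ≢ y → 1 < ∣ p ∣
x∈p∧y∈p∧x≢y⇒1<∣p∣ {x = x} {p = p} x∈p y∈p x≢y =
  subst (_< ∣ p ∣) (∣⁅x⁆∣≡1 x)
    (p⊂q⇒∣p∣<∣q∣ ((λ w∈ → subst (_∈ p) (sym (x∈⁅y⁆⇒x≡y x w∈)) x∈p) ,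
                  _ , y∈p , x≢y⇒x∉⁅y⁆ (λ y≡x → x≢y (sym y≡x))))

∣q∣<∣p∣⇒∃x∈p∖q : ∣ q ∣ < ∣ p ∣ → ∃ λ x → x ∈ p × x ∉ q
∣q∣<∣p∣⇒∃x∈p∖q {q = q} {p = p} ∣q∣<∣p∣ with any? (λ x → (x ∈? p) ×-dec ¬? (x ∈? q))
... | yes found = found
... | no none = ⊥-elim (<⇒≱ ∣q∣<∣p∣ (p⊆q⇒∣p∣≤∣q∣ p⊆q))
  where
  p⊆q : p ⊆ q
  p⊆q {x} x∈p with x ∈? q
  ... | yes x∈q = x∈q
  ... | no x∉q = ⊥-elim (none (x , x∈p , x∉q))

3≤∣p∣⇒∃x∈p-y-z : 3 ≤ ∣ p ∣ → ∀ (y z : Fin n) → ∃ λ x → x ∈ p × x ≢ y × x ≢ z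
3≤∣p∣⇒∃x∈p-y-z 3≤∣p∣ y z
  with ∣q∣<∣p∣⇒∃x∈p∖q {q = ⁅ y ⁆ ∪ ⁅ z ⁆} (≤-trans (s≤s ∣⁅y⁆∪⁅z⁆∣≤2) 3≤∣p∣)
  where
  ∣⁅y⁆∪⁅z⁆∣≤2 : ∣ ⁅ y ⁆ ∪ ⁅ z ⁆ ∣ ≤ 2
  ∣⁅y⁆∪⁅z⁆∣≤2 = ≤-trans (∣p∪q∣≤∣p∣+∣q∣ ⁅ y ⁆ ⁅ z ⁆) (≤-reflexive (cong₂ _+_ (∣⁅x⁆∣≡1 y) (∣⁅x⁆∣≡1 z)))
... | x , x∈p , x∉ = x , x∈p , x∉⁅y⁆∪⁅z⁆⇒x≢y {z = z} x∉ , x∉⁅y⁆∪⁅z⁆⇒x≢z {y = y} x∉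

p⊆q∪⁅y⁆∧∣p∩q∣≤1⇒p≡⁅y⁆∪⁅x⁆ : p ⊆ q ∪ ⁅ y ⁆ → 1 < ∣ p ∣ → ∣ p ∩ q ∣ ≤ 1 →
                            ∃ λ x → x ∈ q × p ≡ ⁅ y ⁆ ∪ ⁅ x ⁆
p⊆q∪⁅y⁆∧∣p∩q∣≤1⇒p≡⁅y⁆∪⁅x⁆ {p = p} {q = q} {y = y} p⊆q∪⁅y⁆ 1<∣p∣ ∣p∩q∣≤1
  with ∣q∣<∣p∣⇒∃x∈p∖q {q = ⁅ y ⁆} (subst (_< ∣ p ∣) (sym (∣⁅x⁆∣≡1 y)) 1<∣p∣)
... | x , x∈p , x∉⁅y⁆ = x , ∈q x∈p x≢y , ⊆-antisym p⊆⁅y⁆∪⁅x⁆ (x∈p∧y∈p⇒⁅x⁆∪⁅y⁆⊆p y∈p x∈p)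
  where
  x≢y : x ≢ y
  x≢y = x∉⁅y⁆⇒x≢y x∉⁅y⁆
  ∈q : ∀ {w} → w ∈ p → w ≢ y → w ∈ q
  ∈q {w} w∈p w≢y = [ (λ w∈q → w∈q) , (λ w∈⁅y⁆ → ⊥-elim (w≢y (x∈⁅y⁆⇒x≡y y w∈⁅y⁆))) ]
                     (x∈p∪q⁻ q ⁅ y ⁆ (p⊆q∪⁅y⁆ w∈p))
  p⊆⁅y⁆∪⁅x⁆ : p ⊆ ⁅ y ⁆ ∪ ⁅ x ⁆
  p⊆⁅y⁆∪⁅x⁆ {w} w∈p with w ≟ y | w ≟ x
  ... | yes refl | _ = x∈⁅x⁆∪⁅y⁆
  ... | no _ | yes refl = y∈⁅x⁆∪⁅y⁆
  ... | no w≢y | no w≢x = ⊥-elim (<⇒≱ (x∈p∧y∈p∧x≢y⇒1<∣p∣ (x∈p∩q⁺ (w∈p , ∈q w∈p w≢y))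
                                                          (x∈p∩q⁺ (x∈p , ∈q x∈p x≢y)) w≢x) ∣p∩q∣≤1)
  y∈p : y ∈ p
  y∈p with y ∈? p
  ... | yes y∈p = y∈p
  ... | no y∉p = ⊥-elim (<⇒≱ (≤-trans 1<∣p∣ (p⊆q⇒∣p∣≤∣q∣ p⊆p∩q)) ∣p∩q∣≤1)
    where
    p⊆p∩q : p ⊆ p ∩ q
    p⊆p∩q w∈p = x∈p∩q⁺ (w∈p , ∈q w∈p (λ { refl → y∉p w∈p }))

module _ (G : Tournament n) where

  open Tournament G using () renaming (_⇒_ to _⟶_)

  infix 4 _⇉_ _⇇_

  _⇉_ _⇇_ : Fin n → Subset n → Set
  v ⇉ X = ∀ x → x ∈ X → v ⟶ x
  v ⇇ X = ∀ x → x ∈ X → x ⟶ v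

  ⇉-⊆ : S ⊆ T → u ⇉ T → u ⇉ S
  ⇉-⊆ S⊆T u⇉T x x∈S = u⇉T x (S⊆T x∈S)

  ⇇-⊆ : S ⊆ T → u ⇇ T → u ⇇ S
  ⇇-⊆ S⊆T u⇇T x x∈S = u⇇T x (S⊆T x∈S)

  ⇉-∪ : u ⇉ S → u ⇉ T → u ⇉ S ∪ T
  ⇉-∪ {S = S} {T = T} u⇉S u⇉T x x∈ = [ u⇉S x , u⇉T x ] (x∈p∪q⁻ S T x∈)

  ⇇-∪ : u ⇇ S → u ⇇ T → u ⇇ S ∪ T
  ⇇-∪ {S = S} {T = T} u⇇S u⇇T x x∈ = [ u⇇S x , u⇇T x ] (x∈p∪q⁻ S T x∈)

  ⇉-pair : u ⟶ x → u ⟶ y → u ⇉ ⁅ x ⁆ ∪ ⁅ y ⁆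
  ⇉-pair u⟶x u⟶y w w∈ with x∈⁅y⁆∪⁅z⁆⁻ w∈
  ... | inj₁ refl = u⟶x
  ... | inj₂ refl = u⟶y

  ⇇-pair : x ⟶ u → y ⟶ u → u ⇇ ⁅ x ⁆ ∪ ⁅ y ⁆
  ⇇-pair x⟶u y⟶u w w∈ with x∈⁅y⁆∪⁅z⁆⁻ w∈
  ... | inj₁ refl = x⟶u
  ... | inj₂ refl = y⟶u

  _⟶?_ : ∀ x y → Dec (x ⟶ y)
  x ⟶? y with x ≟ y
  ... | yes refl = no (irrefl G x)
  ... | no x≢y = Sum.[ yes , (λ y⟶x → no (asym G y x y⟶x)) ] (total G x y x≢y)

  homogeneous? : ∀ S X → Dec (IsHomogeneous G S X)
  homogeneous? S X =
    (X ⊆? S) ×-dec all? (λ v → (v ∈? S) →-dec (¬? (v ∈? X) →-dec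
      (all? (λ x → (x ∈? X) →-dec (v ⟶? x)) ⊎-dec all? (λ x → (x ∈? X) →-dec (x ⟶? v)))))

  nontrivialHomogeneous? : ∀ S X → Dec (IsNontrivialHomogeneous G S X)
  nontrivialHomogeneous? S X = homogeneous? S X ×-dec (1 <? ∣ X ∣) ×-dec (∣ X ∣ <? ∣ S ∣)

  -- IsPrime is a negation, so a witness of non-primality is obtained by exhaustive search.
  ¬prime⇒∃nontrivialHomogeneous : ¬ IsPrime G S → ∃ (IsNontrivialHomogeneous G S)
  ¬prime⇒∃nontrivialHomogeneous {S = S} ¬prime with anySubset? (nontrivialHomogeneous? S)
  ... | yes found = found
  ... | no none = ⊥-elim (¬prime (λ X nontrivial → none (X , nontrivial)))

  homogeneous⇒¬prime : IsHomogeneous G S X → x ∈ X → y ∈ X → x ≢ y → z ∈ S → z ∉ X → ¬ IsPrime G S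
  homogeneous⇒¬prime {X = X} hom x∈X y∈X x≢y z∈S z∉X prime =
    prime X (hom , x∈p∧y∈p∧x≢y⇒1<∣p∣ x∈X y∈X x≢y , p⊂q⇒∣p∣<∣q∣ (proj₁ hom , _ , z∈S , z∉X))

  homogeneous-∩ : IsHomogeneous G S X → T ⊆ S → IsHomogeneous G T (X ∩ T)
  homogeneous-∩ {X = X} {T = T} (_ , hom) T⊆S =
    p∩q⊆q X T ,
    λ v v∈T v∉X∩T → Sum.map (⇉-⊆ (p∩q⊆p X T)) (⇇-⊆ (p∩q⊆p X T))
                            (hom v (T⊆S v∈T) (λ v∈X → v∉X∩T (x∈p∩q⁺ (v∈X , v∈T))))

  prime∧1<∣X∩T∣⇒T⊆X : IsPrime G T → IsHomogeneous G S X → T ⊆ S → 1 < ∣ X ∩ T ∣ → T ⊆ X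
  prime∧1<∣X∩T∣⇒T⊆X {T = T} {X = X} prime hom T⊆S 1<∣X∩T∣ {t} t∈T with t ∈? X
  ... | yes t∈X = t∈X
  ... | no t∉X = ⊥-elim (prime (X ∩ T) (homogeneous-∩ hom T⊆S , 1<∣X∩T∣ , ∣X∩T∣<∣T∣))
    where
    ∣X∩T∣<∣T∣ : ∣ X ∩ T ∣ < ∣ T ∣
    ∣X∩T∣<∣T∣ = p⊂q⇒∣p∣<∣q∣ (p∩q⊆q X T , t , t∈T , λ t∈X∩T → t∉X (p∩q⊆p X T t∈X∩T))

  proper-homogeneous-⊇⇒uniform : IsHomogeneous G (H ∪ ⁅ u ⁆) X → H ⊆ X → ∣ X ∣ < ∣ H ∪ ⁅ u ⁆ ∣ →
                                 u ⇉ H ⊎ u ⇇ H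
  proper-homogeneous-⊇⇒uniform {H = H} {u = u} {X = X} (_ , hom) H⊆X ∣X∣<∣S∣ =
    Sum.map (⇉-⊆ H⊆X) (⇇-⊆ H⊆X) (hom u (q⊆p∪q H ⁅ u ⁆ (x∈⁅x⁆ u)) u∉X)
    where
    u∉X : u ∉ X
    u∉X u∈X = <⇒≱ ∣X∣<∣S∣ (p⊆q⇒∣p∣≤∣q∣ S⊆X)
      where
      S⊆X : H ∪ ⁅ u ⁆ ⊆ X
      S⊆X v∈S = [ H⊆X , (λ v∈⁅u⁆ → subst (_∈ X) (sym (x∈⁅y⁆⇒x≡y u v∈⁅u⁆)) u∈X) ] (x∈p∪q⁻ H ⁅ u ⁆ v∈S)

  -- W is where the twin of u is known to lie.
  data Extension (H : Subset n) (u : Fin n) (W : Subset n) : Set where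
    dominating : u ⇉ H → Extension H u W
    dominated  : u ⇇ H → Extension H u W
    twin       : x ∈ W → IsHomogeneous G (H ∪ ⁅ u ⁆) (⁅ u ⁆ ∪ ⁅ x ⁆) → Extension H u W

  nonprime-extension : IsPrime G H → ¬ IsPrime G (H ∪ ⁅ u ⁆) → Extension H u H
  nonprime-extension {H = H} {u = u} prime nonprime
    with ¬prime⇒∃nontrivialHomogeneous nonprime
  ... | X , hom , 1<∣X∣ , ∣X∣<∣S∣ with 1 <? ∣ X ∩ H ∣
  ... | yes 1<∣X∩H∣ =
    Sum.[ dominating , dominated ]
      (proper-homogeneous-⊇⇒uniform hom (prime∧1<∣X∩T∣⇒T⊆X prime hom (p⊆p∪q ⁅ u ⁆) 1<∣X∩H∣) ∣X∣<∣S∣)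
  ... | no 1≮∣X∩H∣ with p⊆q∪⁅y⁆∧∣p∩q∣≤1⇒p≡⁅y⁆∪⁅x⁆ (proj₁ hom) 1<∣X∣ (≮⇒≥ 1≮∣X∩H∣)
  ... | x , x∈H , refl = twin x∈H hom

  twin-beats : IsHomogeneous G S (⁅ u ⁆ ∪ ⁅ x ⁆) → z ∈ S → z ∉ ⁅ u ⁆ ∪ ⁅ x ⁆ → u ⟶ z → x ⟶ z
  twin-beats {u = u} {z = z} (_ , hom) z∈S z∉ u⟶z with hom z z∈S z∉
  ... | inj₁ z⇉ = ⊥-elim (asym G u z u⟶z (z⇉ u x∈⁅x⁆∪⁅y⁆))
  ... | inj₂ z⇇ = z⇇ _ y∈⁅x⁆∪⁅y⁆

  twin-beaten : IsHomogeneous G S (⁅ u ⁆ ∪ ⁅ x ⁆) → z ∈ S → z ∉ ⁅ u ⁆ ∪ ⁅ x ⁆ → z ⟶ u → z ⟶ x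
  twin-beaten {u = u} {z = z} (_ , hom) z∈S z∉ z⟶u with hom z z∈S z∉
  ... | inj₁ z⇉ = z⇉ _ y∈⁅x⁆∪⁅y⁆
  ... | inj₂ z⇇ = ⊥-elim (asym G z u z⟶u (z⇇ u x∈⁅x⁆∪⁅y⁆))

  uniform-twin⇒homogeneous : IsHomogeneous G S (⁅ u ⁆ ∪ ⁅ x ⁆) → T ⊆ S → u ∉ T → u ⇉ T ⊎ u ⇇ T →
                             IsHomogeneous G T (T - x)
  uniform-twin⇒homogeneous {u = u} {x = x} {T = T} hom T⊆S u∉T uniform =
    T-x⊆T , λ v v∈T v∉T-x → subst (λ w → w ⇉ T - x ⊎ w ⇇ T - x) (sym (≡x v∈T v∉T-x)) x-uniform
    where
    T-x⊆T : T - x ⊆ T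
    T-x⊆T = p─q⊆p T ⁅ x ⁆
    ≡x : ∀ {v} → v ∈ T → v ∉ T - x → v ≡ x
    ≡x {v} v∈T v∉T-x with v ≟ x
    ... | yes v≡x = v≡x
    ... | no v≢x = ⊥-elim (v∉T-x (x∈p∧x≢y⇒x∈p-y v∈T v≢x))
    ∉twin : ∀ {z} → z ∈ T - x → z ∉ ⁅ u ⁆ ∪ ⁅ x ⁆
    ∉twin z∈T-x = x≢y∧x≢z⇒x∉⁅y⁆∪⁅z⁆ (λ { refl → u∉T (T-x⊆T z∈T-x) }) (x∈p-y⇒x≢y z∈T-x)
    x-uniform : x ⇉ T - x ⊎ x ⇇ T - x
    x-uniform = Sum.map
      (λ u⇉T z z∈ → twin-beats hom (T⊆S (T-x⊆T z∈)) (∉twin z∈) (u⇉T z (T-x⊆T z∈)))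
      (λ u⇇T z z∈ → twin-beaten hom (T⊆S (T-x⊆T z∈)) (∉twin z∈) (u⇇T z (T-x⊆T z∈)))
      uniform

  twins⇒homogeneous : IsHomogeneous G S₁ (⁅ u ⁆ ∪ ⁅ x ⁆) → IsHomogeneous G S₂ (⁅ u ⁆ ∪ ⁅ y ⁆) →
                      T ⊆ S₁ → T ⊆ S₂ → u ∉ T → x ∈ T → y ∈ T → IsHomogeneous G T (⁅ x ⁆ ∪ ⁅ y ⁆)
  twins⇒homogeneous {u = u} {x = x} {y = y} {T = T} hom₁ hom₂ T⊆S₁ T⊆S₂ u∉T x∈T y∈T =
    x∈p∧y∈p⇒⁅x⁆∪⁅y⁆⊆p x∈T y∈T , uniform
    where
    uniform : ∀ v → v ∈ T → v ∉ ⁅ x ⁆ ∪ ⁅ y ⁆ → v ⇉ ⁅ x ⁆ ∪ ⁅ y ⁆ ⊎ v ⇇ ⁅ x ⁆ ∪ ⁅ y ⁆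
    uniform v v∈T v∉ =
      [ (λ u⟶v → inj₂ (⇇-pair (twin-beats hom₁ (T⊆S₁ v∈T) v∉₁ u⟶v) (twin-beats hom₂ (T⊆S₂ v∈T) v∉₂ u⟶v)))
      , (λ v⟶u → inj₁ (⇉-pair (twin-beaten hom₁ (T⊆S₁ v∈T) v∉₁ v⟶u) (twin-beaten hom₂ (T⊆S₂ v∈T) v∉₂ v⟶u)))
      ]′ (total G u v u≢v)
      where
      u≢v : u ≢ v
      u≢v refl = u∉T v∈T
      v∉₁ : v ∉ ⁅ u ⁆ ∪ ⁅ x ⁆
      v∉₁ = x≢y∧x≢z⇒x∉⁅y⁆∪⁅z⁆ (u≢v ∘ sym) (x∉⁅y⁆∪⁅z⁆⇒x≢y v∉)
      v∉₂ : v ∉ ⁅ u ⁆ ∪ ⁅ y ⁆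
      v∉₂ = x≢y∧x≢z⇒x∉⁅y⁆∪⁅z⁆ (u≢v ∘ sym) (x∉⁅y⁆∪⁅z⁆⇒x≢z v∉)

  homogeneous-glue : (∀ v → v ∈ S₁ ⊎ v ∈ S₂) → IsHomogeneous G S₁ X → IsHomogeneous G S₂ X →
                     IsHomogeneous G ⊤ X
  homogeneous-glue covered (_ , hom₁) (_ , hom₂) =
    (λ _ → ∈⊤) , λ v _ v∉X → [ (λ v∈S₁ → hom₁ v v∈S₁ v∉X) , (λ v∈S₂ → hom₂ v v∈S₂ v∉X) ] (covered v)

  uniform⇒homogeneous : (∀ v → v ≢ u → v ∈ X) → u ⇉ X ⊎ u ⇇ X → IsHomogeneous G ⊤ X
  uniform⇒homogeneous {u = u} {X = X} covered uniform = (λ _ → ∈⊤) , hom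
    where
    hom : ∀ v → v ∈ ⊤ → v ∉ X → v ⇉ X ⊎ v ⇇ X
    hom v _ v∉X with v ≟ u
    ... | yes refl = uniform
    ... | no v≢u = ⊥-elim (v∉X (covered v v≢u))

  locate-twin : (∀ {x} → x ∈ H → x ∈ K → x ∈ I) → Extension H u H →
                (∃ λ x → x ∈ H × x ∉ K × IsHomogeneous G (H ∪ ⁅ u ⁆) (⁅ u ⁆ ∪ ⁅ x ⁆)) ⊎ Extension H u I
  locate-twin _ (dominating u⇉H) = inj₂ (dominating u⇉H)
  locate-twin _ (dominated u⇇H) = inj₂ (dominated u⇇H)
  locate-twin {K = K} ∈I (twin {x = x} x∈H hom) with x ∈? K
  ... | yes x∈K = inj₂ (twin (∈I x∈H x∈K) hom)
  ... | no x∉K = inj₁ (x , x∈H , x∉K , hom)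

  module _ {u : Fin n} {H₁ H₂ : Subset n} (cover : H₁ ∪ H₂ ≡ ⊤ - u)
           (prime-G : IsPrime G ⊤) (prime-H₁₂ : IsPrime G (H₁ ∩ H₂)) (3≤∣H₁₂∣ : 3 ≤ ∣ H₁ ∩ H₂ ∣)
           where

    private
      H₁₂ : Subset n
      H₁₂ = H₁ ∩ H₂

      fresh : ∀ y z → ∃ λ w → w ∈ H₁₂ × w ≢ y × w ≢ z
      fresh = 3≤∣p∣⇒∃x∈p-y-z {p = H₁₂} 3≤∣H₁₂∣

      H₁₂⊆H₁ : H₁₂ ⊆ H₁
      H₁₂⊆H₁ = p∩q⊆p H₁ H₂

      H₁₂⊆H₂ : H₁₂ ⊆ H₂
      H₁₂⊆H₂ = p∩q⊆q H₁ H₂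

      H₁₂⊆H₁∪H₂ : H₁₂ ⊆ H₁ ∪ H₂
      H₁₂⊆H₁∪H₂ = p⊆p∪q H₂ ∘ H₁₂⊆H₁

      u∉H₁∪H₂ : u ∉ H₁ ∪ H₂
      u∉H₁∪H₂ u∈ = x∈p-y⇒x≢y (subst (u ∈_) cover u∈) refl

      u∉H₁₂ : u ∉ H₁₂
      u∉H₁₂ = u∉H₁∪H₂ ∘ H₁₂⊆H₁∪H₂

      ≢u⇒∈H₁∪H₂ : ∀ v → v ≢ u → v ∈ H₁ ∪ H₂
      ≢u⇒∈H₁∪H₂ v v≢u = subst (v ∈_) (sym cover) (x∈p∧x≢y⇒x∈p-y ∈⊤ v≢u)

      ∈H₁∪⁅u⁆⊎∈H₂∪⁅u⁆ : ∀ v → v ∈ H₁ ∪ ⁅ u ⁆ ⊎ v ∈ H₂ ∪ ⁅ u ⁆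
      ∈H₁∪⁅u⁆⊎∈H₂∪⁅u⁆ v with v ≟ u
      ... | yes refl = inj₁ (q⊆p∪q H₁ ⁅ u ⁆ (x∈⁅x⁆ u))
      ... | no v≢u = Sum.map (p⊆p∪q ⁅ u ⁆) (p⊆p∪q ⁅ u ⁆) (x∈p∪q⁻ H₁ H₂ (≢u⇒∈H₁∪H₂ v v≢u))

    ¬uniform-on-H₁∪H₂ : ¬ (u ⇉ H₁ ∪ H₂ ⊎ u ⇇ H₁ ∪ H₂)
    ¬uniform-on-H₁∪H₂ uniform with fresh u u
    ... | a , a∈H₁₂ , _ with fresh a a
    ... | b , b∈H₁₂ , b≢a , _ =
      homogeneous⇒¬prime (uniform⇒homogeneous ≢u⇒∈H₁∪H₂ uniform)
        (H₁₂⊆H₁∪H₂ a∈H₁₂) (H₁₂⊆H₁∪H₂ b∈H₁₂) (b≢a ∘ sym) ∈⊤ u∉H₁∪H₂ prime-G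

    ¬uniform-with-twin : H₁₂ ⊆ H → u ⇉ H₁₂ ⊎ u ⇇ H₁₂ → x ∈ H₁₂ →
                         ¬ IsHomogeneous G (H ∪ ⁅ u ⁆) (⁅ u ⁆ ∪ ⁅ x ⁆)
    ¬uniform-with-twin {x = x} H₁₂⊆H uniform x∈H₁₂ hom with fresh x x
    ... | c , c∈H₁₂ , c≢x , _ with fresh x c
    ... | d , d∈H₁₂ , d≢x , d≢c =
      homogeneous⇒¬prime (uniform-twin⇒homogeneous hom (p⊆p∪q ⁅ u ⁆ ∘ H₁₂⊆H) u∉H₁₂ uniform)
        (x∈p∧x≢y⇒x∈p-y c∈H₁₂ c≢x) (x∈p∧x≢y⇒x∈p-y d∈H₁₂ d≢x) (d≢c ∘ sym)
        x∈H₁₂ (λ x∈H₁₂-x → x∈p-y⇒x≢y x∈H₁₂-x refl) prime-H₁₂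

    ¬twins : x ∈ H₁₂ → y ∈ H₁₂ → IsHomogeneous G (H₁ ∪ ⁅ u ⁆) (⁅ u ⁆ ∪ ⁅ x ⁆) →
             ¬ IsHomogeneous G (H₂ ∪ ⁅ u ⁆) (⁅ u ⁆ ∪ ⁅ y ⁆)
    ¬twins {x = x} {y = y} x∈H₁₂ y∈H₁₂ hom₁ hom₂ with fresh x y | x ≟ y
    ... | w , w∈H₁₂ , w≢x , w≢y | no x≢y =
      homogeneous⇒¬prime
        (twins⇒homogeneous hom₁ hom₂ (p⊆p∪q ⁅ u ⁆ ∘ H₁₂⊆H₁) (p⊆p∪q ⁅ u ⁆ ∘ H₁₂⊆H₂) u∉H₁₂ x∈H₁₂ y∈H₁₂)
        x∈⁅x⁆∪⁅y⁆ y∈⁅x⁆∪⁅y⁆ x≢y w∈H₁₂ (x≢y∧x≢z⇒x∉⁅y⁆∪⁅z⁆ w≢x w≢y) prime-H₁₂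
    ... | _ | yes refl with fresh u x
    ... | w , _ , w≢u , w≢x =
      homogeneous⇒¬prime (homogeneous-glue ∈H₁∪⁅u⁆⊎∈H₂∪⁅u⁆ hom₁ hom₂)
        x∈⁅x⁆∪⁅y⁆ y∈⁅x⁆∪⁅y⁆ (λ { refl → u∉H₁₂ x∈H₁₂ }) ∈⊤ (x≢y∧x≢z⇒x∉⁅y⁆∪⁅z⁆ w≢u w≢x) prime-G

    extensions-incompatible : Extension H₁ u H₁₂ → Extension H₂ u H₁₂ → ⊥
    extensions-incompatible (twin x∈H₁₂ hom₁) (twin y∈H₁₂ hom₂) = ¬twins x∈H₁₂ y∈H₁₂ hom₁ hom₂
    extensions-incompatible (twin x∈H₁₂ hom₁) (dominating u⇉H₂) =
      ¬uniform-with-twin H₁₂⊆H₁ (inj₁ (⇉-⊆ H₁₂⊆H₂ u⇉H₂)) x∈H₁₂ hom₁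
    extensions-incompatible (twin x∈H₁₂ hom₁) (dominated u⇇H₂) =
      ¬uniform-with-twin H₁₂⊆H₁ (inj₂ (⇇-⊆ H₁₂⊆H₂ u⇇H₂)) x∈H₁₂ hom₁
    extensions-incompatible (dominating u⇉H₁) (twin y∈H₁₂ hom₂) =
      ¬uniform-with-twin H₁₂⊆H₂ (inj₁ (⇉-⊆ H₁₂⊆H₁ u⇉H₁)) y∈H₁₂ hom₂
    extensions-incompatible (dominated u⇇H₁) (twin y∈H₁₂ hom₂) =
      ¬uniform-with-twin H₁₂⊆H₂ (inj₂ (⇇-⊆ H₁₂⊆H₁ u⇇H₁)) y∈H₁₂ hom₂
    extensions-incompatible (dominating u⇉H₁) (dominating u⇉H₂) =
      ¬uniform-on-H₁∪H₂ (inj₁ (⇉-∪ u⇉H₁ u⇉H₂))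
    extensions-incompatible (dominated u⇇H₁) (dominated u⇇H₂) =
      ¬uniform-on-H₁∪H₂ (inj₂ (⇇-∪ u⇇H₁ u⇇H₂))
    extensions-incompatible (dominating u⇉H₁) (dominated u⇇H₂) with fresh u u
    ... | a , a∈H₁₂ , _ = asym G u a (u⇉H₁ a (H₁₂⊆H₁ a∈H₁₂)) (u⇇H₂ a (H₁₂⊆H₂ a∈H₁₂))
    extensions-incompatible (dominated u⇇H₁) (dominating u⇉H₂) with fresh u u
    ... | a , a∈H₁₂ , _ = asym G a u (u⇇H₁ a (H₁₂⊆H₁ a∈H₁₂)) (u⇉H₂ a (H₁₂⊆H₂ a∈H₁₂))

proposition3p6 : ∀ {n} (G : Tournament n) (u : Fin n) (H₁ H₂ : Subset n) →
    IsPrime G ⊤ →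
    Nonempty H₁ → Nonempty H₂ →
    IsPrime G H₁ → IsPrime G H₂ →
    H₁ ∪ H₂ ≡ ⊤ - u →
    ¬ IsPrime G (H₁ ∪ ⁅ u ⁆) → ¬ IsPrime G (H₂ ∪ ⁅ u ⁆) →
    IsPrime G (H₁ ∩ H₂) → 3 ≤ ∣ H₁ ∩ H₂ ∣ →
    (Σ (Fin n) λ x → x ∈ H₁ × x ∉ H₂ ×
        IsHomogeneous G (H₁ ∪ ⁅ u ⁆) (⁅ u ⁆ ∪ ⁅ x ⁆))
    ⊎
    (Σ (Fin n) λ y → y ∈ H₂ × y ∉ H₁ ×
        IsHomogeneous G (H₂ ∪ ⁅ u ⁆) (⁅ u ⁆ ∪ ⁅ y ⁆))
proposition3p6 G u H₁ H₂ prime-G _ _ prime-H₁ prime-H₂ cover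
               nonprime-H₁+u nonprime-H₂+u prime-H₁₂ 3≤∣H₁₂∣
  with locate-twin G (λ x∈H₁ x∈H₂ → x∈p∩q⁺ (x∈H₁ , x∈H₂)) (nonprime-extension G prime-H₁ nonprime-H₁+u)
     | locate-twin G (λ x∈H₂ x∈H₁ → x∈p∩q⁺ (x∈H₁ , x∈H₂)) (nonprime-extension G prime-H₂ nonprime-H₂+u)
... | inj₁ twin₁ | _ = inj₁ twin₁
... | inj₂ _ | inj₁ twin₂ = inj₂ twin₂
... | inj₂ extension₁ | inj₂ extension₂ =
  ⊥-elim (extensions-incompatible G cover prime-G prime-H₁₂ 3≤∣H₁₂∣ extension₁ extension₂)
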